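{- Let $n\ge 3$ and let $\mathbf P=(P_{ij})_{0\le i,j\le n-1}$ be the $n\times n$ transition probability matrix with entries $P_{00}=5/6,\ P_{01}=1/6$; $P_{10}=5/6,\ P_{12}=1/6$; for $2\le i\le n-2$: $P_{i0}=2/3,\ P_{i,i-1}=P_{i,i+1}=1/6$; $P_{n-1,0}=2/3,\ P_{n-1,n-2}=1/6,\ P_{n-1,n-1}=1/6$; and all other entries $0$. Then the steady state probability vector $\vec\pi=(\pi_0,\dots,\pi_{n-1})$ of $\mathbf P$ is given by $$\pi_i=\frac{B_{n-i}-B_{n-i-1}}{B_n},\qquad i=0,1,\dots,n-1.$$
   Context: The balancing numbers $B_m$ are defined by $B_0=0$, $B_1=1$, $B_{m+1}=6B_m-B_{m-1}$. The steady state probability vector of a transition probability matrix $\mathbf P$ is the probability row vector $\vec\pi$ (nonnegative entries summing to $1$) satisfying $\vec\pi=\vec\pi\mathbf P$. -}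

module Defs where

open import Data.Nat as ℕ using (ℕ; zero; suc; _∸_)
open import Data.Nat.Properties as ℕP using ()
open import Data.Integer as ℤ using (ℤ; +_)
open import Data.Rational as ℚ using (ℚ; 0ℚ; _+_; _*_; _-_; _÷_; ≢-nonZero)
open import Data.Rational.Properties as ℚP using ()
open import Data.Fin using (Fin; zero; suc; toℕ)
open import Data.Bool using (Bool; true; false; if_then_else_)
open import Relation.Nullary using (yes; no)
open import Relation.Nullary.Decidable using (⌊_⌋)
open import Relation.Binary.PropositionalEquality using (_≡_)
open import Data.Product using (_×_)

B : ℕ → ℤ
B zero = + 0
B (suc zero) = + 1
B (suc (suc m)) = (+ 6) ℤ.* B (suc m) ℤ.- B m

-- Division on ℚ with the convention p / 0 = 0 (only used with nonzero denominators)
_÷₀_ : ℚ → ℚ → ℚ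
p ÷₀ q with q ℚ.≟ 0ℚ
... | yes _ = 0ℚ
... | no q≢0 = _÷_ p q {{≢-nonZero q≢0}}

∑ : ∀ {n} → (Fin n → ℚ) → ℚ
∑ {zero} f = 0ℚ
∑ {suc n} f = f zero + ∑ (λ i → f (suc i))

_==_ : ℕ → ℕ → Bool
a == b = ⌊ a ℕ.≟ b ⌋

Pentry : ℕ → ℕ → ℕ → ℚ
Pentry n i j =
  if i == 0 then
    (if j == 0 then (+ 5) ℚ./ 6 else if j == 1 then (+ 1) ℚ./ 6 else 0ℚ)
  else if i == 1 then
    (if j == 0 then (+ 5) ℚ./ 6 else if j == 2 then (+ 1) ℚ./ 6 else 0ℚ)
  else if i == (n ∸ 1) then
    (if j == 0 then (+ 2) ℚ./ 3
     else if j == (n ∸ 2) then (+ 1) ℚ./ 6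
     else if j == (n ∸ 1) then (+ 1) ℚ./ 6 else 0ℚ)
  else
    (if j == 0 then (+ 2) ℚ./ 3
     else if j == (i ∸ 1) then (+ 1) ℚ./ 6
     else if j == suc i then (+ 1) ℚ./ 6 else 0ℚ)

P : (n : ℕ) → Fin n → Fin n → ℚ
P n i j = Pentry n (toℕ i) (toℕ j)

IsSteadyState : ∀ {n} → (Fin n → Fin n → ℚ) → (Fin n → ℚ) → Set
IsSteadyState {n} M x =
  (∀ i → 0ℚ ℚ.≤ x i) × (∑ x ≡ ℚ.1ℚ) × (∀ j → x j ≡ ∑ (λ i → x i * M i j))

πB : (n : ℕ) → Fin n → ℚ
πB n i = ℚ._/_ (B (n ∸ toℕ i) ℤ.- B (n ∸ toℕ i ∸ 1)) 1 ÷₀ ℚ._/_ (B n) 1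

{-# OPTIONS --safe #-}
-- Write Δₖ = Bₖ − Bₖ₋₁. In columns 1, …, n−1 the equations π = π P read
-- πⱼ = (πⱼ₋₁ + πⱼ₊₁)/6, where the last column has πₙ₋₁ in place of πₙ. This
-- second-order recurrence determines π downwards from πₙ₋₁, and k ↦ Δₙ₋ₖ solves it
-- because Δ obeys the balancing recurrence with Δ₁ = 1, Δ₂ = 5; using
-- Bₙ = 6Bₙ₋₁ − Bₙ₋₂ it satisfies the column-0 equation too. So the invariant vectors
-- are exactly the multiples c·Δₙ₋ₖ. They sum to c·Bₙ by telescoping, normalisation
-- forces c = 1/Bₙ, and Δ ≥ 0 because B is increasing.
module Submission where

open import Defs
open import Data.Nat using (ℕ; _≤_)
open import Data.Fin using (Fin)
open import Data.Rational using (ℚ)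
open import Data.Product using (_×_)
open import Relation.Binary.PropositionalEquality using (_≡_)

open import Algebra.Bundles using (Ring)
open import Data.Bool using (true; false; if_then_else_)
open import Data.Fin as Fin using (toℕ)
import Data.Fin.Properties as FinP
open import Data.Integer as ℤ using (ℤ; +_)
import Data.Integer.Properties as ℤP
open import Data.Nat as ℕ using (zero; suc; _∸_; _<_; z≤n; s≤s)
import Data.Nat.Properties as ℕP
open import Data.Product using (_,_; proj₁; proj₂)
open import Data.Rational as ℚ using (0ℚ; 1ℚ; _+_; _*_; _-_; 1/_)
import Data.Rational.Properties as ℚP
open import Data.Rational.Unnormalised as ℚᵘ using (*≡*)
import Data.Rational.Unnormalised.Properties as ℚᵘP
open import Data.Sum using (inj₁; inj₂)
open import Function using (_∘_)
open import Level using (0ℓ)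
open import Relation.Binary.PropositionalEquality
  using (refl; sym; trans; cong; cong₂; subst; _≢_; _≗_; module ≡-Reasoning)
open import Relation.Nullary using (yes; no)
open import Relation.Nullary.Decidable using (isYes≗does; dec-true; dec-false; dec⇒maybe)
import Tactic.RingSolver as RingSolver
import Tactic.RingSolver.Core.AlmostCommutativeRing as ACR

open import Algebra.Properties.Semiring.Sum (Ring.semiring ℚP.+-*-ring)
  using (sum; sum-cong-≗; ∑-distrib-+; *-distribˡ-sum; *-distribʳ-sum)

-- The zero test lets the solver discard monomials that cancel.
ℚ-ring : ACR.AlmostCommutativeRing 0ℓ 0ℓ
ℚ-ring = ACR.fromCommutativeRing ℚP.+-*-commutativeRing (λ x → dec⇒maybe (0ℚ ℚ.≟ x))

ι : ℤ → ℚ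
ι z = z ℚ./ 1

toℚᵘ-ι : ∀ z → ℚ.toℚᵘ (ι z) ℚᵘ.≃ z ℚᵘ./ 1
toℚᵘ-ι z = ℚP.toℚᵘ-fromℚᵘ (z ℚᵘ./ 1)

ι-+ : ∀ a b → ι (a ℤ.+ b) ≡ ι a + ι b
ι-+ a b = ℚP.toℚᵘ-injective (begin
  ℚ.toℚᵘ (ι (a ℤ.+ b))                 ≈⟨ toℚᵘ-ι (a ℤ.+ b) ⟩
  (a ℤ.+ b) ℚᵘ./ 1
    ≈⟨ *≡* (cong (ℤ._* + 1) (sym (cong₂ ℤ._+_ (ℤP.*-identityʳ a) (ℤP.*-identityʳ b)))) ⟩
  a ℚᵘ./ 1 ℚᵘ.+ b ℚᵘ./ 1                ≈⟨ ℚᵘP.+-cong (toℚᵘ-ι a) (toℚᵘ-ι b) ⟨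
  ℚ.toℚᵘ (ι a) ℚᵘ.+ ℚ.toℚᵘ (ι b)        ≈⟨ ℚP.toℚᵘ-homo-+ (ι a) (ι b) ⟨
  ℚ.toℚᵘ (ι a + ι b)                    ∎)
  where open ℚᵘP.≃-Reasoning

ι-* : ∀ a b → ι (a ℤ.* b) ≡ ι a * ι b
ι-* a b = ℚP.toℚᵘ-injective (begin
  ℚ.toℚᵘ (ι (a ℤ.* b))                 ≈⟨ toℚᵘ-ι (a ℤ.* b) ⟩
  (a ℚᵘ./ 1) ℚᵘ.* (b ℚᵘ./ 1)            ≈⟨ ℚᵘP.*-cong (toℚᵘ-ι a) (toℚᵘ-ι b) ⟨
  ℚ.toℚᵘ (ι a) ℚᵘ.* ℚ.toℚᵘ (ι b)        ≈⟨ ℚP.toℚᵘ-homo-* (ι a) (ι b) ⟨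
  ℚ.toℚᵘ (ι a * ι b)                    ∎)
  where open ℚᵘP.≃-Reasoning

ι-neg : ∀ a → ι (ℤ.- a) ≡ ℚ.- ι a
ι-neg a = ℚP.toℚᵘ-injective (begin
  ℚ.toℚᵘ (ι (ℤ.- a))     ≈⟨ toℚᵘ-ι (ℤ.- a) ⟩
  ℚᵘ.- (a ℚᵘ./ 1)         ≈⟨ ℚᵘP.-‿cong (toℚᵘ-ι a) ⟨
  ℚᵘ.- ℚ.toℚᵘ (ι a)       ≈⟨ ℚP.toℚᵘ-homo‿- (ι a) ⟨
  ℚ.toℚᵘ (ℚ.- ι a)        ∎)
  where open ℚᵘP.≃-Reasoning

ι-- : ∀ a b → ι (a ℤ.- b) ≡ ι a - ι b
ι-- a b = trans (ι-+ a (ℤ.- b)) (cong (λ q → ι a + q) (ι-neg b))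

-- The truncated subtraction never truncates, since Bℕ is increasing.
Bℕ : ℕ → ℕ
Bℕ zero = 0
Bℕ (suc zero) = 1
Bℕ (suc (suc k)) = 6 ℕ.* Bℕ (suc k) ∸ Bℕ k

Bℕ-nondecreasing : ∀ k → Bℕ k ≤ Bℕ (suc k)
Bℕ-nondecreasing zero = z≤n
Bℕ-nondecreasing (suc k) = begin
  x              ≤⟨ ℕP.m≤n*m x 5 ⟩
  5 ℕ.* x        ≡⟨ ℕP.m+n∸m≡n x (5 ℕ.* x) ⟨
  6 ℕ.* x ∸ x    ≤⟨ ℕP.∸-monoʳ-≤ (6 ℕ.* x) (Bℕ-nondecreasing k) ⟩
  6 ℕ.* x ∸ Bℕ k ∎
  where
  open ℕP.≤-Reasoning
  x : ℕ
  x = Bℕ (suc k)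

Bℕ-positive : ∀ k → 0 < Bℕ (suc k)
Bℕ-positive zero = s≤s z≤n
Bℕ-positive (suc k) = ℕP.<-≤-trans (Bℕ-positive k) (Bℕ-nondecreasing (suc k))

B≡Bℕ : ∀ k → B k ≡ + Bℕ k
B≡Bℕ zero = refl
B≡Bℕ (suc zero) = refl
B≡Bℕ (suc (suc k)) = begin
  + 6 ℤ.* B (suc k) ℤ.- B k    ≡⟨ cong₂ (λ u v → + 6 ℤ.* u ℤ.- v) (B≡Bℕ (suc k)) (B≡Bℕ k) ⟩
  + 6 ℤ.* + x ℤ.- + Bℕ k       ≡⟨ cong (ℤ._- + Bℕ k) (ℤP.pos-* 6 x) ⟨
  + (6 ℕ.* x) ℤ.- + Bℕ k       ≡⟨ ℤP.m-n≡m⊖n (6 ℕ.* x) (Bℕ k) ⟩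
  6 ℕ.* x ℤ.⊖ Bℕ k             ≡⟨ ℤP.⊖-≥ (ℕP.≤-trans (Bℕ-nondecreasing k) (ℕP.m≤n*m x 6)) ⟩
  + (6 ℕ.* x ∸ Bℕ k)           ∎
  where
  open ≡-Reasoning
  x : ℕ
  x = Bℕ (suc k)

Bℚ : ℕ → ℚ
Bℚ k = ι (B k)

-- πB n i is definitionally ΔB (n ∸ toℕ i) ÷₀ Bℚ n.
ΔB : ℕ → ℚ
ΔB k = ι (B k ℤ.- B (k ∸ 1))

ΔB≡Bℚ-Bℚ : ∀ k → ΔB k ≡ Bℚ k - Bℚ (k ∸ 1)
ΔB≡Bℚ-Bℚ k = ι-- (B k) (B (k ∸ 1))

BalancingRecurrence : (ℕ → ℚ) → Set
BalancingRecurrence f = ∀ k → f (2 ℕ.+ k) ≡ ι (+ 6) * f (1 ℕ.+ k) - f k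

Bℚ-recurrence : BalancingRecurrence Bℚ
Bℚ-recurrence k = trans (ι-- (+ 6 ℤ.* B (suc k)) (B k)) (cong (_- Bℚ k) (ι-* (+ 6) (B (suc k))))

difference-recurrence : ∀ {f} → BalancingRecurrence f → BalancingRecurrence (λ k → f (suc k) - f k)
difference-recurrence {f} rec k = begin
  f (3 ℕ.+ k) - f (2 ℕ.+ k)                ≡⟨ cong (_- f (2 ℕ.+ k)) (rec (suc k)) ⟩
  (six * f (2 ℕ.+ k) - f (1 ℕ.+ k)) - f (2 ℕ.+ k)
    ≡⟨ cong ((six * f (2 ℕ.+ k) - f (1 ℕ.+ k)) -_) (rec k) ⟩
  (six * f (2 ℕ.+ k) - f (1 ℕ.+ k)) - (six * f (1 ℕ.+ k) - f k)
    ≡⟨ regroup (f k) (f (1 ℕ.+ k)) (f (2 ℕ.+ k)) ⟩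
  six * (f (2 ℕ.+ k) - f (1 ℕ.+ k)) - (f (1 ℕ.+ k) - f k) ∎
  where
  open ≡-Reasoning
  six : ℚ
  six = ι (+ 6)
  regroup : ∀ a b c → (six * c - b) - (six * b - a) ≡ six * (c - b) - (b - a)
  regroup = RingSolver.solve-∀ ℚ-ring

ΔB-recurrence : BalancingRecurrence (ΔB ∘ suc)
ΔB-recurrence k = begin
  ΔB (3 ℕ.+ k)                                 ≡⟨ ΔB≡Bℚ-Bℚ (3 ℕ.+ k) ⟩
  Bℚ (3 ℕ.+ k) - Bℚ (2 ℕ.+ k)                  ≡⟨ difference-recurrence {Bℚ} Bℚ-recurrence k ⟩
  ι (+ 6) * (Bℚ (2 ℕ.+ k) - Bℚ (1 ℕ.+ k)) - (Bℚ (1 ℕ.+ k) - Bℚ k)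
    ≡⟨ cong₂ (λ u v → ι (+ 6) * u - v) (ΔB≡Bℚ-Bℚ (2 ℕ.+ k)) (ΔB≡Bℚ-Bℚ (1 ℕ.+ k)) ⟨
  ι (+ 6) * ΔB (2 ℕ.+ k) - ΔB (1 ℕ.+ k)      ∎
  where open ≡-Reasoning

ΔB-nonNegative : ∀ k → ℚ.NonNegative (ΔB k)
ΔB-nonNegative k = subst ℚ.NonNegative (cong ι (sym ΔB-in-ℕ)) (ℚP.normalize-nonNeg (Bℕ k ∸ Bℕ (k ∸ 1)) 1)
  where
  Bℕ-pred-≤ : ∀ k → Bℕ (k ∸ 1) ≤ Bℕ k
  Bℕ-pred-≤ zero = z≤n
  Bℕ-pred-≤ (suc k) = Bℕ-nondecreasing k
  ΔB-in-ℕ : B k ℤ.- B (k ∸ 1) ≡ + (Bℕ k ∸ Bℕ (k ∸ 1))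
  ΔB-in-ℕ = begin
    B k ℤ.- B (k ∸ 1)             ≡⟨ cong₂ ℤ._-_ (B≡Bℕ k) (B≡Bℕ (k ∸ 1)) ⟩
    + Bℕ k ℤ.- + Bℕ (k ∸ 1)       ≡⟨ ℤP.m-n≡m⊖n (Bℕ k) (Bℕ (k ∸ 1)) ⟩
    Bℕ k ℤ.⊖ Bℕ (k ∸ 1)           ≡⟨ ℤP.⊖-≥ (Bℕ-pred-≤ k) ⟩
    + (Bℕ k ∸ Bℕ (k ∸ 1))         ∎
    where open ≡-Reasoning

Bℚ-positive : ∀ k → ℚ.Positive (Bℚ (suc k))
Bℚ-positive k = subst ℚ.Positive (cong ι (sym (B≡Bℕ (suc k))))
  (ℚP.normalize-pos (Bℕ (suc k)) 1 {{_}} {{ℕ.>-nonZero (Bℕ-positive k)}})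

∑< : ℕ → (ℕ → ℚ) → ℚ
∑< n g = sum {n} (g ∘ toℕ)

∑≡sum : ∀ {n} (f : Fin n → ℚ) → ∑ f ≡ sum f
∑≡sum {zero} f = refl
∑≡sum {suc n} f = cong (λ s → f Fin.zero + s) (∑≡sum (f ∘ Fin.suc))

∑<-cong : ∀ n {g h : ℕ → ℚ} → (∀ k → k < n → g k ≡ h k) → ∑< n g ≡ ∑< n h
∑<-cong n g≡h = sum-cong-≗ (λ i → g≡h (toℕ i) (FinP.toℕ<n i))

∑<-*-zeroʳ : ∀ n (X : ℕ → ℚ) → ∑< n (λ k → X k * 0ℚ) ≡ 0ℚ
∑<-*-zeroʳ n X = trans (sym (*-distribʳ-sum {n} 0ℚ (X ∘ toℕ))) (ℚP.*-zeroʳ (∑< n X))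

==-suc : ∀ a b → (suc a == suc b) ≡ (a == b)
==-suc a b = trans (isYes≗does (suc a ℕ.≟ suc b)) (sym (isYes≗does (a ℕ.≟ b)))

==-refl : ∀ a → (a == a) ≡ true
==-refl a = trans (isYes≗does (a ℕ.≟ a)) (dec-true (a ℕ.≟ a) refl)

==-≢ : ∀ {a b} → a ≢ b → (a == b) ≡ false
==-≢ {a} {b} a≢b = trans (isYes≗does (a ℕ.≟ b)) (dec-false (a ℕ.≟ b) a≢b)

δ : ℕ → ℕ → ℚ
δ a k = if a == k then 1ℚ else 0ℚ

δ-suc : ∀ a k → δ (suc a) (suc k) ≡ δ a k
δ-suc a k = cong (if_then 1ℚ else 0ℚ) (==-suc a k)

∑<-δ : ∀ n (X : ℕ → ℚ) {a} → a < n → ∑< n (λ k → X k * δ a k) ≡ X a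
∑<-δ (suc n) X {zero} _ = begin
  X 0 * 1ℚ + ∑< n (λ k → X (suc k) * 0ℚ)
    ≡⟨ cong₂ _+_ (ℚP.*-identityʳ (X 0)) (∑<-*-zeroʳ n (X ∘ suc)) ⟩
  X 0 + 0ℚ                                 ≡⟨ ℚP.+-identityʳ (X 0) ⟩
  X 0                                      ∎
  where open ≡-Reasoning
∑<-δ (suc n) X {suc a} (s≤s a<n) = begin
  X 0 * 0ℚ + ∑< n (λ k → X (suc k) * δ (suc a) (suc k))
    ≡⟨ cong₂ _+_ (ℚP.*-zeroʳ (X 0)) (∑<-cong n (λ k _ → cong (X (suc k) *_) (δ-suc a k))) ⟩
  0ℚ + ∑< n (λ k → X (suc k) * δ a k)     ≡⟨ ℚP.+-identityˡ _ ⟩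
  ∑< n (λ k → X (suc k) * δ a k)          ≡⟨ ∑<-δ n (X ∘ suc) a<n ⟩
  X (suc a)                                ∎
  where open ≡-Reasoning

∑<-telescope : ∀ (f : ℕ → ℚ) n → f 0 ≡ 0ℚ → ∑< n (λ k → f (n ∸ k) - f (n ∸ k ∸ 1)) ≡ f n
∑<-telescope f zero f0≡0 = sym f0≡0
∑<-telescope f (suc n) f0≡0 = begin
  (f (suc n) - f n) + ∑< n (λ k → f (n ∸ k) - f (n ∸ k ∸ 1))
    ≡⟨ cong (λ s → (f (suc n) - f n) + s) (∑<-telescope f n f0≡0) ⟩
  (f (suc n) - f n) + f n  ≡⟨ cancel (f (suc n)) (f n) ⟩
  f (suc n)                ∎
  where
  open ≡-Reasoning
  cancel : ∀ a b → (a - b) + b ≡ a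
  cancel = RingSolver.solve-∀ ℚ-ring

⅙ ⅔ : ℚ
⅙ = + 1 ℚ./ 6
⅔ = + 2 ℚ./ 3

Pentry-column₀ : ∀ m k → Pentry (3 ℕ.+ m) k 0 ≡ ⅔ + (δ 0 k + δ 1 k) * ⅙
Pentry-column₀ m zero = refl
Pentry-column₀ m (suc zero) = refl
Pentry-column₀ m (suc (suc k)) with suc (suc k) ℕ.≟ suc (suc m)
... | yes _ = refl
... | no _ = refl

-- Row 2 + k is the last row exactly when k ≡ m; every other test compares j with k or m.
Pentry-column-interior : ∀ m k {j} → j ≤ m → Pentry (3 ℕ.+ m) k (suc j) ≡ (δ j k + δ (2 ℕ.+ j) k) * ⅙
Pentry-column-interior m zero {zero} _ = refl
Pentry-column-interior m zero {suc j} _ = refl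
Pentry-column-interior m (suc zero) {zero} _ = refl
Pentry-column-interior m (suc zero) {suc zero} _ = refl
Pentry-column-interior m (suc zero) {suc (suc j)} _ = refl
Pentry-column-interior m (suc (suc k)) {j} j≤m with suc (suc k) ℕ.≟ suc (suc m)
... | yes refl
  rewrite ==-≢ {suc j} {2 ℕ.+ m} (ℕP.<⇒≢ (s≤s (s≤s j≤m)))
        | ==-≢ {j} {2 ℕ.+ m} (ℕP.<⇒≢ (s≤s (ℕP.m≤n⇒m≤1+n j≤m)))
        | ==-suc (suc j) (suc m)
        | ==-suc j m
  with j == m
... | true = refl
... | false = refl
Pentry-column-interior m (suc (suc k)) {j} j≤m | no _
  rewrite ==-suc (suc j) (suc k)
        | ==-suc j k
        | ==-suc j (2 ℕ.+ k)
  with j ℕ.≟ k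
... | yes refl rewrite ==-≢ {j} {2 ℕ.+ j} (ℕP.<⇒≢ (ℕP.m<n+m j {2} (s≤s z≤n))) = refl
... | no _ with j == (2 ℕ.+ k)
...   | true = refl
...   | false = refl

Pentry-column-last : ∀ m k → k < 3 ℕ.+ m →
                     Pentry (3 ℕ.+ m) k (2 ℕ.+ m) ≡ (δ (1 ℕ.+ m) k + δ (2 ℕ.+ m) k) * ⅙
Pentry-column-last m zero _ = refl
Pentry-column-last zero (suc zero) _ = refl
Pentry-column-last (suc m) (suc zero) _ = refl
Pentry-column-last m (suc (suc k)) (s≤s (s≤s (s≤s k≤m))) with suc (suc k) ℕ.≟ suc (suc m)
... | yes refl
  rewrite ==-≢ {2 ℕ.+ m} {1 ℕ.+ m} (ℕP.<⇒≢ (ℕP.n<1+n (suc m)) ∘ sym)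
        | ==-≢ {1 ℕ.+ m} {2 ℕ.+ m} (ℕP.<⇒≢ (ℕP.n<1+n (suc m)))
        | ==-refl (2 ℕ.+ m)
  = refl
... | no k≢m
  rewrite ==-≢ {2 ℕ.+ m} {1 ℕ.+ k} (ℕP.<⇒≢ (s≤s (s≤s k≤m)) ∘ sym)
        | ==-≢ {2 ℕ.+ m} {2 ℕ.+ k} (k≢m ∘ sym)
        | ==-suc (1 ℕ.+ m) (2 ℕ.+ k)
  with suc m == suc (suc k)
... | true = refl
... | false = refl

∑<-δ-pair : ∀ n (X : ℕ → ℚ) {a b} w → a < n → b < n →
            ∑< n (λ k → X k * ((δ a k + δ b k) * w)) ≡ (X a + X b) * w
∑<-δ-pair n X {a} {b} w a<n b<n = begin
  ∑< n (λ k → X k * ((δ a k + δ b k) * w))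
    ≡⟨ ∑<-cong n (λ k _ → distribute (X k) (δ a k) (δ b k) w) ⟩
  ∑< n (λ k → (X k * δ a k + X k * δ b k) * w)
    ≡⟨ *-distribʳ-sum {n} w (λ i → X (toℕ i) * δ a (toℕ i) + X (toℕ i) * δ b (toℕ i)) ⟨
  ∑< n (λ k → X k * δ a k + X k * δ b k) * w
    ≡⟨ cong (_* w) (∑-distrib-+ {n} (λ i → X (toℕ i) * δ a (toℕ i))
                                     (λ i → X (toℕ i) * δ b (toℕ i))) ⟩
  (∑< n (λ k → X k * δ a k) + ∑< n (λ k → X k * δ b k)) * w
    ≡⟨ cong (_* w) (cong₂ _+_ (∑<-δ n X a<n) (∑<-δ n X b<n)) ⟩
  (X a + X b) * w ∎
  where
  open ≡-Reasoning
  distribute : ∀ x d e v → x * ((d + e) * v) ≡ (x * d + x * e) * v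
  distribute = RingSolver.solve-∀ ℚ-ring

module Columns (m : ℕ) (X : ℕ → ℚ) where

  n : ℕ
  n = 3 ℕ.+ m

  column₀ : ∑< n (λ k → X k * Pentry n k 0) ≡ ∑< n X * ⅔ + (X 0 + X 1) * ⅙
  column₀ = begin
    ∑< n (λ k → X k * Pentry n k 0)
      ≡⟨ ∑<-cong n (λ k _ → expand k) ⟩
    ∑< n (λ k → X k * ⅔ + X k * ((δ 0 k + δ 1 k) * ⅙))
      ≡⟨ ∑-distrib-+ {n} (λ i → X (toℕ i) * ⅔)
                         (λ i → X (toℕ i) * ((δ 0 (toℕ i) + δ 1 (toℕ i)) * ⅙)) ⟩
    ∑< n (λ k → X k * ⅔) + ∑< n (λ k → X k * ((δ 0 k + δ 1 k) * ⅙))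
      ≡⟨ cong₂ _+_ (sym (*-distribʳ-sum {n} ⅔ (X ∘ toℕ)))
                   (∑<-δ-pair n X ⅙ (s≤s z≤n) (s≤s (s≤s z≤n))) ⟩
    ∑< n X * ⅔ + (X 0 + X 1) * ⅙  ∎
    where
    open ≡-Reasoning
    expand : ∀ k → X k * Pentry n k 0 ≡ X k * ⅔ + X k * ((δ 0 k + δ 1 k) * ⅙)
    expand k = trans (cong (X k *_) (Pentry-column₀ m k)) (ℚP.*-distribˡ-+ (X k) ⅔ ((δ 0 k + δ 1 k) * ⅙))

  column-interior : ∀ {j} → j ≤ m → ∑< n (λ k → X k * Pentry n k (suc j)) ≡ (X j + X (2 ℕ.+ j)) * ⅙
  column-interior j≤m = trans (∑<-cong n (λ k _ → cong (X k *_) (Pentry-column-interior m k j≤m)))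
    (∑<-δ-pair n X ⅙ (s≤s (ℕP.m≤n⇒m≤o+n 2 j≤m)) (s≤s (s≤s (s≤s j≤m))))

  column-last : ∑< n (λ k → X k * Pentry n k (2 ℕ.+ m)) ≡ (X (1 ℕ.+ m) + X (2 ℕ.+ m)) * ⅙
  column-last = trans (∑<-cong n (λ k k<n → cong (X k *_) (Pentry-column-last m k k<n)))
    (∑<-δ-pair n X ⅙ (ℕP.m<n+m (suc m) {2} (s≤s z≤n)) (ℕP.n<1+n (2 ℕ.+ m)))

IsInvariant : ℕ → (ℕ → ℚ) → Set
IsInvariant n X = ∀ j → j < n → X j ≡ ∑< n (λ k → X k * Pentry n k j)

balancingProfile : ℕ → ℚ → ℕ → ℚ
balancingProfile n c k = c * ΔB (n ∸ k)

∑<-balancingProfile : ∀ n c → ∑< n (balancingProfile n c) ≡ c * Bℚ n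
∑<-balancingProfile n c = begin
  ∑< n (λ k → c * ΔB (n ∸ k))  ≡⟨ *-distribˡ-sum {n} c (λ i → ΔB (n ∸ toℕ i)) ⟨
  c * ∑< n (λ k → ΔB (n ∸ k))  ≡⟨ cong (c *_) (∑<-cong n (λ k _ → ΔB≡Bℚ-Bℚ (n ∸ k))) ⟩
  c * ∑< n (λ k → Bℚ (n ∸ k) - Bℚ (n ∸ k ∸ 1)) ≡⟨ cong (c *_) (∑<-telescope Bℚ n refl) ⟩
  c * Bℚ n                     ∎
  where open ≡-Reasoning

module ProfileBalance (m : ℕ) (c : ℚ) where

  Y : ℕ → ℚ
  Y = balancingProfile (3 ℕ.+ m) c

  open Columns m Y using (n; column₀; column-interior; column-last)
  open ≡-Reasoning

  balance₀ : Y 0 ≡ ∑< n (λ k → Y k * Pentry n k 0)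
  balance₀ = sym (begin
    ∑< n (λ k → Y k * Pentry n k 0)    ≡⟨ column₀ ⟩
    ∑< n Y * ⅔ + (Y 0 + Y 1) * ⅙
      ≡⟨ cong₂ (λ s d → s * ⅔ + (c * d + Y 1) * ⅙) (∑<-balancingProfile n c) (ΔB≡Bℚ-Bℚ n) ⟩
    c * Bℚ n * ⅔ + (c * (Bℚ n - Bℚ (2 ℕ.+ m)) + c * ΔB (2 ℕ.+ m)) * ⅙
      ≡⟨ cong (λ d → c * Bℚ n * ⅔ + (c * (Bℚ n - Bℚ (2 ℕ.+ m)) + c * d) * ⅙)
              (ΔB≡Bℚ-Bℚ (2 ℕ.+ m)) ⟩
    c * Bℚ n * ⅔ + (c * (Bℚ n - Bℚ (2 ℕ.+ m)) + c * (Bℚ (2 ℕ.+ m) - Bℚ (1 ℕ.+ m))) * ⅙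
      ≡⟨ identity (Bℚ (1 ℕ.+ m)) (Bℚ (2 ℕ.+ m)) (Bℚ n) (Bℚ-recurrence (suc m)) ⟩
    c * (Bℚ n - Bℚ (2 ℕ.+ m))          ≡⟨ cong (c *_) (ΔB≡Bℚ-Bℚ n) ⟨
    Y 0                                ∎)
    where
    identity : ∀ b₁ b₂ b₃ → b₃ ≡ ι (+ 6) * b₂ - b₁ →
               c * b₃ * ⅔ + (c * (b₃ - b₂) + c * (b₂ - b₁)) * ⅙ ≡ c * (b₃ - b₂)
    identity b₁ b₂ _ refl = solved c b₁ b₂
      where
      solved : ∀ a b₁ b₂ →
               a * (ι (+ 6) * b₂ - b₁) * ⅔ + (a * ((ι (+ 6) * b₂ - b₁) - b₂) + a * (b₂ - b₁)) * ⅙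
               ≡ a * ((ι (+ 6) * b₂ - b₁) - b₂)
      solved = RingSolver.solve-∀ ℚ-ring

  balance-interior : ∀ {j} → j ≤ m → Y (suc j) ≡ ∑< n (λ k → Y k * Pentry n k (suc j))
  balance-interior {j} j≤m = sym (begin
    ∑< n (λ k → Y k * Pentry n k (suc j))             ≡⟨ column-interior j≤m ⟩
    (c * ΔB (3 ℕ.+ m ∸ j) + c * ΔB (1 ℕ.+ m ∸ j)) * ⅙
      ≡⟨ cong₂ (λ u v → (c * ΔB u + c * ΔB v) * ⅙) (ℕP.+-∸-assoc 3 j≤m) (ℕP.+-∸-assoc 1 j≤m) ⟩
    (c * ΔB (3 ℕ.+ e) + c * ΔB (1 ℕ.+ e)) * ⅙
      ≡⟨ cong (λ d → (c * d + c * ΔB (1 ℕ.+ e)) * ⅙) (ΔB-recurrence e) ⟩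
    (c * (ι (+ 6) * ΔB (2 ℕ.+ e) - ΔB (1 ℕ.+ e)) + c * ΔB (1 ℕ.+ e)) * ⅙
      ≡⟨ identity c (ΔB (2 ℕ.+ e)) (ΔB (1 ℕ.+ e)) ⟩
    c * ΔB (2 ℕ.+ e)                                  ≡⟨ cong (λ u → c * ΔB u) (ℕP.+-∸-assoc 2 j≤m) ⟨
    Y (suc j)                                         ∎)
    where
    e : ℕ
    e = m ∸ j
    identity : ∀ a d₂ d₁ → (a * (ι (+ 6) * d₂ - d₁) + a * d₁) * ⅙ ≡ a * d₂
    identity = RingSolver.solve-∀ ℚ-ring

  balance-last : Y (2 ℕ.+ m) ≡ ∑< n (λ k → Y k * Pentry n k (2 ℕ.+ m))
  balance-last = sym (begin
    ∑< n (λ k → Y k * Pentry n k (2 ℕ.+ m))          ≡⟨ column-last ⟩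
    (c * ΔB (2 ℕ.+ m ∸ m) + c * ΔB (1 ℕ.+ m ∸ m)) * ⅙
      ≡⟨ cong₂ (λ u v → (c * ΔB u + c * ΔB v) * ⅙) (ℕP.m+n∸n≡m 2 m) (ℕP.m+n∸n≡m 1 m) ⟩
    (c * ΔB 2 + c * ΔB 1) * ⅙                        ≡⟨ identity c ⟩
    c * ΔB 1                                          ≡⟨ cong (λ u → c * ΔB u) (ℕP.m+n∸n≡m 1 m) ⟨
    Y (2 ℕ.+ m)                                       ∎)
    where
    identity : ∀ a → (a * ΔB 2 + a * ΔB 1) * ⅙ ≡ a * ΔB 1
    identity = RingSolver.solve-∀ ℚ-ring

balancingProfile-invariant : ∀ m c → IsInvariant (3 ℕ.+ m) (balancingProfile (3 ℕ.+ m) c)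
balancingProfile-invariant m c zero _ = ProfileBalance.balance₀ m c
balancingProfile-invariant m c (suc j) (s≤s (s≤s j≤1+m)) with ℕP.m≤n⇒m<n∨m≡n j≤1+m
... | inj₁ (s≤s j≤m) = ProfileBalance.balance-interior m c j≤m
... | inj₂ refl = ProfileBalance.balance-last m c

BalancedInterior : ℕ → (ℕ → ℚ) → Set
BalancedInterior N f = ∀ k → k ≤ N → f (suc k) ≡ (f k + f (2 ℕ.+ k)) * ⅙

+-*⅙-cancelʳ : ∀ {a b} v → (a + v) * ⅙ ≡ (b + v) * ⅙ → a ≡ b
+-*⅙-cancelʳ {a} {b} v eq = begin
  a                         ≡⟨ undo a v ⟩
  (a + v) * ⅙ * ι (+ 6) - v ≡⟨ cong (λ t → t * ι (+ 6) - v) eq ⟩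
  (b + v) * ⅙ * ι (+ 6) - v ≡⟨ undo b v ⟨
  b                         ∎
  where
  open ≡-Reasoning
  undo : ∀ a v → a ≡ (a + v) * ⅙ * ι (+ 6) - v
  undo = RingSolver.solve-∀ ℚ-ring

balancedInterior-unique : ∀ N {f g} → BalancedInterior N f → BalancedInterior N g →
                          f (1 ℕ.+ N) ≡ g (1 ℕ.+ N) → f (2 ℕ.+ N) ≡ g (2 ℕ.+ N) →
                          ∀ k → k ≤ 2 ℕ.+ N → f k ≡ g k
balancedInterior-unique N {f} {g} bal-f bal-g f≡g₁ f≡g₂ k k≤2+N
  with ℕP.m≤n⇒m<n∨m≡n k≤2+N
... | inj₁ (s≤s k≤1+N) = proj₁ (agree-from (suc N ∸ k) k (ℕP.m∸n+n≡m k≤1+N))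
  where
  agree-from : ∀ d k → d ℕ.+ k ≡ suc N → f k ≡ g k × f (suc k) ≡ g (suc k)
  agree-from zero _ refl = f≡g₁ , f≡g₂
  agree-from (suc d) k d+k≡N = +-*⅙-cancelʳ (f (2 ℕ.+ k)) step , f≡g₁′
    where
    k≤N : k ≤ N
    k≤N = subst (k ≤_) (ℕP.suc-injective d+k≡N) (ℕP.m≤n+m k d)
    next : f (suc k) ≡ g (suc k) × f (2 ℕ.+ k) ≡ g (2 ℕ.+ k)
    next = agree-from d (suc k) (trans (ℕP.+-suc d k) d+k≡N)
    f≡g₁′ : f (suc k) ≡ g (suc k)
    f≡g₁′ = proj₁ next
    step : (f k + f (2 ℕ.+ k)) * ⅙ ≡ (g k + f (2 ℕ.+ k)) * ⅙
    step = begin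
      (f k + f (2 ℕ.+ k)) * ⅙  ≡⟨ bal-f k k≤N ⟨
      f (suc k)                 ≡⟨ f≡g₁′ ⟩
      g (suc k)                 ≡⟨ bal-g k k≤N ⟩
      (g k + g (2 ℕ.+ k)) * ⅙  ≡⟨ cong (λ t → (g k + t) * ⅙) (proj₂ next) ⟨
      (g k + f (2 ℕ.+ k)) * ⅙  ∎
      where open ≡-Reasoning
... | inj₂ refl = f≡g₂

invariant⇒balancingProfile : ∀ m {X} → IsInvariant (3 ℕ.+ m) X →
                             ∀ k → k < 3 ℕ.+ m → X k ≡ balancingProfile (3 ℕ.+ m) (X (2 ℕ.+ m)) k
invariant⇒balancingProfile m {X} X-inv k (s≤s k≤2+m) =
  balancedInterior-unique m {X} {Y} (interior X-inv) (interior Y-inv) X≡Y₁ X≡Y₂ k k≤2+m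
  where
  Y : ℕ → ℚ
  Y = balancingProfile (3 ℕ.+ m) (X (2 ℕ.+ m))
  Y-inv : IsInvariant (3 ℕ.+ m) Y
  Y-inv = balancingProfile-invariant m (X (2 ℕ.+ m))
  interior : ∀ {Z} → IsInvariant (3 ℕ.+ m) Z → BalancedInterior m Z
  interior {Z} Z-inv j j≤m =
    trans (Z-inv (suc j) (s≤s (s≤s (ℕP.m≤n⇒m≤1+n j≤m)))) (Columns.column-interior m Z j≤m)
  last : ∀ {Z} → IsInvariant (3 ℕ.+ m) Z → Z (2 ℕ.+ m) ≡ (Z (1 ℕ.+ m) + Z (2 ℕ.+ m)) * ⅙
  last {Z} Z-inv = trans (Z-inv (2 ℕ.+ m) (ℕP.n<1+n (2 ℕ.+ m))) (Columns.column-last m Z)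
  X≡Y₂ : X (2 ℕ.+ m) ≡ Y (2 ℕ.+ m)
  X≡Y₂ = begin
    X (2 ℕ.+ m)                       ≡⟨ ℚP.*-identityʳ (X (2 ℕ.+ m)) ⟨
    X (2 ℕ.+ m) * ΔB 1                ≡⟨ cong (λ u → X (2 ℕ.+ m) * ΔB u) (ℕP.m+n∸n≡m 1 m) ⟨
    Y (2 ℕ.+ m)                       ∎
    where open ≡-Reasoning
  X≡Y₁ : X (1 ℕ.+ m) ≡ Y (1 ℕ.+ m)
  X≡Y₁ = +-*⅙-cancelʳ (X (2 ℕ.+ m)) (begin
    (X (1 ℕ.+ m) + X (2 ℕ.+ m)) * ⅙   ≡⟨ last X-inv ⟨
    X (2 ℕ.+ m)                       ≡⟨ X≡Y₂ ⟩
    Y (2 ℕ.+ m)                       ≡⟨ last Y-inv ⟩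
    (Y (1 ℕ.+ m) + Y (2 ℕ.+ m)) * ⅙   ≡⟨ cong (λ t → (Y (1 ℕ.+ m) + t) * ⅙) X≡Y₂ ⟨
    (Y (1 ℕ.+ m) + X (2 ℕ.+ m)) * ⅙   ∎)
    where open ≡-Reasoning

extend : ∀ {n} → (Fin n → ℚ) → ℕ → ℚ
extend {zero} x k = 0ℚ
extend {suc n} x zero = x Fin.zero
extend {suc n} x (suc k) = extend (x ∘ Fin.suc) k

extend-toℕ : ∀ {n} (x : Fin n → ℚ) i → extend x (toℕ i) ≡ x i
extend-toℕ x Fin.zero = refl
extend-toℕ x (Fin.suc i) = extend-toℕ (x ∘ Fin.suc) i

invariant⇒stationary : ∀ {n X} → IsInvariant n X → ∀ j → X (toℕ j) ≡ ∑ (λ i → X (toℕ i) * P n i j)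
invariant⇒stationary {n} {X} X-inv j =
  trans (X-inv (toℕ j) (FinP.toℕ<n j)) (sym (∑≡sum (λ i → X (toℕ i) * P n i j)))

stationary⇒invariant : ∀ {n} (x : Fin n → ℚ) → (∀ j → x j ≡ ∑ (λ i → x i * P n i j)) →
                       IsInvariant n (extend x)
stationary⇒invariant {n} x x-stat k k<n =
  subst (λ k → extend x k ≡ ∑< n (λ a → extend x a * Pentry n a k)) (FinP.toℕ-fromℕ< k<n)
        (at (Fin.fromℕ< k<n))
  where
  at : ∀ j → extend x (toℕ j) ≡ ∑< n (λ a → extend x a * Pentry n a (toℕ j))
  at j = begin
    extend x (toℕ j)                     ≡⟨ extend-toℕ x j ⟩
    x j                                  ≡⟨ x-stat j ⟩
    ∑ (λ i → x i * P n i j)              ≡⟨ ∑≡sum (λ i → x i * P n i j) ⟩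
    sum (λ i → x i * P n i j)            ≡⟨ sum-cong-≗ (λ i → cong (_* P n i j) (extend-toℕ x i)) ⟨
    ∑< n (λ a → extend x a * Pentry n a (toℕ j)) ∎
    where open ≡-Reasoning

IsSteadyState-resp-≗ : ∀ {n} {M : Fin n → Fin n → ℚ} {x y} → x ≗ y → IsSteadyState M x → IsSteadyState M y
IsSteadyState-resp-≗ {n} {M} {x} {y} x≗y (nonNeg , normalised , stationary) =
  (λ i → subst (0ℚ ℚ.≤_) (x≗y i) (nonNeg i)) ,
  trans (sym (∑-cong x≗y)) normalised ,
  λ j → trans (sym (x≗y j)) (trans (stationary j) (∑-cong (λ i → cong (_* M i j) (x≗y i))))
  where
  ∑-cong : ∀ {f g : Fin n → ℚ} → f ≗ g → ∑ f ≡ ∑ g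
  ∑-cong {f} {g} f≗g = trans (∑≡sum f) (trans (sum-cong-≗ f≗g) (sym (∑≡sum g)))

÷₀≡*1/ : ∀ p q .{{_ : ℚ.NonZero q}} → p ÷₀ q ≡ p * 1/ q
÷₀≡*1/ p q with q ℚ.≟ 0ℚ
÷₀≡*1/ p .0ℚ {{()}} | yes refl
... | no _ = refl

*≡1⇒≡1/ : ∀ a q .{{_ : ℚ.NonZero q}} → a * q ≡ 1ℚ → a ≡ 1/ q
*≡1⇒≡1/ a q aq≡1 = begin
  a                ≡⟨ ℚP.*-identityʳ a ⟨
  a * 1ℚ           ≡⟨ cong (a *_) (ℚP.*-inverseʳ q) ⟨
  a * (q * 1/ q)   ≡⟨ ℚP.*-assoc a q (1/ q) ⟨
  a * q * 1/ q     ≡⟨ cong (_* 1/ q) aq≡1 ⟩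
  1ℚ * 1/ q        ≡⟨ ℚP.*-identityˡ (1/ q) ⟩
  1/ q             ∎
  where open ≡-Reasoning

module SteadyState (m : ℕ) where

  n : ℕ
  n = 3 ℕ.+ m

  instance
    Bℚ-nonZero : ℚ.NonZero (Bℚ n)
    Bℚ-nonZero = ℚP.pos⇒nonZero (Bℚ n) {{Bℚ-positive (2 ℕ.+ m)}}

    1/Bℚ-nonNegative : ℚ.NonNegative (1/ Bℚ n)
    1/Bℚ-nonNegative = ℚP.pos⇒nonNeg (1/ Bℚ n) {{ℚP.1/pos⇒pos (Bℚ n) {{Bℚ-positive (2 ℕ.+ m)}}}}

  π : ℕ → ℚ
  π = balancingProfile n (1/ Bℚ n)

  πB≡π : ∀ i → πB n i ≡ π (toℕ i)
  πB≡π i = trans (÷₀≡*1/ (ΔB (n ∸ toℕ i)) (Bℚ n)) (ℚP.*-comm (ΔB (n ∸ toℕ i)) (1/ Bℚ n))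

  π-steadyState : IsSteadyState (P n) (π ∘ toℕ)
  π-steadyState = nonNeg , normalised , invariant⇒stationary {n} {π} (balancingProfile-invariant m (1/ Bℚ n))
    where
    nonNeg : ∀ i → 0ℚ ℚ.≤ π (toℕ i)
    nonNeg i = ℚP.nonNegative⁻¹ (π (toℕ i))
      {{ℚP.nonNeg*nonNeg⇒nonNeg (1/ Bℚ n) (ΔB (n ∸ toℕ i)) {{ΔB-nonNegative (n ∸ toℕ i)}}}}
    normalised : ∑ {n} (π ∘ toℕ) ≡ 1ℚ
    normalised = begin
      ∑ {n} (π ∘ toℕ)       ≡⟨ ∑≡sum {n} (π ∘ toℕ) ⟩
      ∑< n π                ≡⟨ ∑<-balancingProfile n (1/ Bℚ n) ⟩
      1/ Bℚ n * Bℚ n        ≡⟨ ℚP.*-inverseˡ (Bℚ n) ⟩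
      1ℚ                    ∎
      where open ≡-Reasoning

  steadyState-unique : ∀ x → IsSteadyState (P n) x → ∀ i → x i ≡ π (toℕ i)
  steadyState-unique x (_ , normalised , stationary) i = begin
    x i                           ≡⟨ extend-toℕ x i ⟨
    X (toℕ i)                     ≡⟨ X≡profile (toℕ i) (FinP.toℕ<n i) ⟩
    balancingProfile n c (toℕ i)  ≡⟨ cong (λ a → balancingProfile n a (toℕ i)) c≡1/Bₙ ⟩
    π (toℕ i)                     ∎
    where
    open ≡-Reasoning
    X : ℕ → ℚ
    X = extend x
    c : ℚ
    c = X (2 ℕ.+ m)
    X≡profile : ∀ k → k < n → X k ≡ balancingProfile n c k
    X≡profile = invariant⇒balancingProfile m (stationary⇒invariant x stationary)
    c≡1/Bₙ : c ≡ 1/ Bℚ n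
    c≡1/Bₙ = *≡1⇒≡1/ c (Bℚ n) (begin
      c * Bℚ n                      ≡⟨ ∑<-balancingProfile n c ⟨
      ∑< n (balancingProfile n c)   ≡⟨ ∑<-cong n X≡profile ⟨
      ∑< n X                        ≡⟨ sum-cong-≗ (extend-toℕ x) ⟩
      sum x                         ≡⟨ ∑≡sum x ⟨
      ∑ x                           ≡⟨ normalised ⟩
      1ℚ                            ∎)

theorem2p3 : (n : ℕ) → 3 ≤ n →
    IsSteadyState (P n) (πB n) ×
    ((x : Fin n → ℚ) → IsSteadyState (P n) x → (i : Fin n) → x i ≡ πB n i)
theorem2p3 (suc (suc (suc m))) (s≤s (s≤s (s≤s _))) =
  IsSteadyState-resp-≗ {M = P n} (sym ∘ πB≡π) π-steadyState ,
  λ x x-steady i → trans (steadyState-unique x x-steady i) (sym (πB≡π i))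
  where open SteadyState m
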